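{- Let $H$ be a $2$-edge-connected undirected graph, let $v$ be a vertex of $H$ that is not an articulation point, and let $C$ be the $2$-vertex-connected component of $H$ containing $v$. Then for every edge $e$ of $H$, the graph $H\setminus\{v,e\}$ is not connected if and only if $e$ belongs to $C$ and $C\setminus\{v,e\}$ is not connected.
   Context: The $2$-vertex-connected components (blocks) of an undirected graph are its maximal biconnected subgraphs; a vertex that is not an articulation point lies in exactly one of them. $H\setminus\{v,e\}$ denotes the graph obtained by deleting the vertex $v$ with its incident edges and the edge $e$. -}

module Defs where

open import Data.Nat using (ℕ)
open import Data.Fin using (Fin)
open import Data.Product using (Σ; ∃; ∃-syntax; _×_; _,_; proj₁; proj₂)
open import Data.Unit using (⊤)
open import Relation.Nullary using (¬_)
open import Relation.Binary.PropositionalEquality using (_≡_; _≢_)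

record Graph : Set where
  field
    n     : ℕ
    m     : ℕ
    end₁  : Fin m → Fin n
    end₂  : Fin m → Fin n
    loopless : ∀ e → end₁ e ≢ end₂ e

module _ (G : Graph) where
  open Graph G

  Joins : Fin m → Fin n → Fin n → Set
  Joins e x y = (end₁ e ≡ x × end₂ e ≡ y) Data.Sum.⊎ (end₁ e ≡ y × end₂ e ≡ x)
    where import Data.Sum

  record Sub : Set₁ where
    field
      V : Fin n → Set
      E : Fin m → Set

  open Sub public

  IsSubgraph : Sub → Set
  IsSubgraph s = ∀ e → E s e → V s (end₁ e) × V s (end₂ e)

  _⊆ˢ_ : Sub → Sub → Set
  s ⊆ˢ t = (∀ x → V s x → V t x) × (∀ e → E s e → E t e)

  whole : Sub
  whole = record { V = λ _ → ⊤ ; E = λ _ → ⊤ }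

  deleteVertex : Sub → Fin n → Sub
  deleteVertex s v = record
    { V = λ x → V s x × x ≢ v
    ; E = λ e → E s e × end₁ e ≢ v × end₂ e ≢ v }

  deleteEdge : Sub → Fin m → Sub
  deleteEdge s f = record { V = V s ; E = λ e → E s e × e ≢ f }

  data Reach (s : Sub) : Fin n → Fin n → Set where
    here : ∀ {x} → Reach s x x
    step : ∀ {x y z} (e : Fin m) → E s e → Joins e x y → Reach s y z → Reach s x z

  Connected : Sub → Set
  Connected s = ∀ x y → V s x → V s y → Reach s x y

  IsArticulationPoint : Sub → Fin n → Set
  IsArticulationPoint s v =
    V s v × ∃[ x ] ∃[ y ] (V s x × V s y × x ≢ v × y ≢ v ×
      Reach s x y × ¬ Reach (deleteVertex s v) x y)

  Biconnected : Sub → Set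
  Biconnected s = Connected s × (∀ w → ¬ IsArticulationPoint s w)

  IsBlock : Sub → Set₁
  IsBlock C = IsSubgraph C × Biconnected C ×
    (∀ D → IsSubgraph D → Biconnected D → C ⊆ˢ D → D ⊆ˢ C)

  TwoEdgeConnected : Set
  TwoEdgeConnected = Connected whole × (∀ e → Connected (deleteEdge whole e))

module Submission where

-- Let a, b be the ends of e and write H∖v, H∖v∖e, C∖v∖e for the deleted graphs.
--
-- (⇐) A simple walk joining two vertices of the block C uses only edges of C:
--     C together with the walk is again biconnected, so maximality of C absorbs
--     it ("ear" lemma).  Hence connectivity of H∖v∖e restricts to C∖v∖e.
-- (⇒) H∖v is connected because v is no articulation point, so H∖v∖e is connected
--     as soon as a and b are joined in it.  If H∖v∖e is disconnected, then a, b ≠ v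
--     and, by 2-edge-connectivity, there is a simple walk Q from a to b avoiding e;
--     Q must pass through v.  The cycle Q + e, together with simple paths in H∖v
--     from every vertex of C∖v to a, forms with C a biconnected subgraph, so
--     e ∈ C by maximality; and C∖v∖e is disconnected since a, b ∈ C.
--
-- Everything is constructive: where connectivity is only known up to double
-- negation we use that double negation commutes with finite products.

open import Defs
import Data.Nat as ℕ
open import Data.Fin using (Fin; zero; suc)
open import Data.Fin.Properties using (_≟_)
open import Data.Product using (Σ; ∃-syntax; _×_; _,_; proj₁; proj₂)
open import Data.Sum using (_⊎_; inj₁; inj₂)
open import Data.Unit using (⊤; tt)
open import Data.Empty using (⊥; ⊥-elim)
open import Relation.Nullary using (¬_; Dec; yes; no)
open import Relation.Nullary.Negation using (¬¬-map; contradiction)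
open import Relation.Nullary.Decidable using (_⊎-dec_; ¬¬-excluded-middle)
open import Relation.Binary.PropositionalEquality using (_≡_; _≢_; refl; sym; subst)
open import Function.Bundles using (_⇔_; mk⇔)

¬¬-Π-Fin : ∀ {k} {P : Fin k → Set} → (∀ i → ¬ ¬ P i) → ¬ ¬ (∀ i → P i)
¬¬-Π-Fin {ℕ.zero} _ notAll = notAll λ ()
¬¬-Π-Fin {ℕ.suc k} h notAll =
  h zero λ p₀ → ¬¬-Π-Fin (λ i → h (suc i)) λ ps → notAll λ { zero → p₀ ; (suc i) → ps i }

¬¬-→ : ∀ {A B : Set} → (A → ¬ ¬ B) → ¬ ¬ (A → B)
¬¬-→ h notImp = notImp λ a → ⊥-elim (h a λ b → notImp λ _ → b)

module Walks (G : Graph) where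
  open Graph G

  _∖_ : Sub G → Fin n → Sub G
  D ∖ z = deleteVertex G D z

  Joins-sym : ∀ {f x y} → Joins G f x y → Joins G f y x
  Joins-sym (inj₁ (p , q)) = inj₂ (p , q)
  Joins-sym (inj₂ (p , q)) = inj₁ (p , q)

  Joins-avoid : ∀ {f x y z} → Joins G f x y → x ≢ z → y ≢ z → end₁ f ≢ z × end₂ f ≢ z
  Joins-avoid (inj₁ (refl , refl)) x≢z y≢z = x≢z , y≢z
  Joins-avoid (inj₂ (refl , refl)) x≢z y≢z = y≢z , x≢z

  Reach-mono : ∀ {s t x y} → (∀ f → E s f → E t f) → Reach G s x y → Reach G t x y
  Reach-mono h here = here
  Reach-mono h (step f fs j ρ) = step f (h f fs) j (Reach-mono h ρ)

  infixr 5 _++_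
  _++_ : ∀ {s x y z} → Reach G s x y → Reach G s y z → Reach G s x z
  here ++ τ = τ
  step f fs j ρ ++ τ = step f fs j (ρ ++ τ)

  reverse : ∀ {s x y} → Reach G s x y → Reach G s y x
  reverse here = here
  reverse (step f fs j ρ) = reverse ρ ++ step f fs (Joins-sym j) here

  _∈ᵥ_ : ∀ {s x y} → Fin n → Reach G s x y → Set
  _∈ᵥ_ {x = x} z here = z ≡ x
  _∈ᵥ_ {x = x} z (step _ _ _ ρ) = z ≡ x ⊎ z ∈ᵥ ρ

  _∈ₑ_ : ∀ {s x y} → Fin m → Reach G s x y → Set
  f ∈ₑ here = ⊥
  f ∈ₑ step g _ _ ρ = f ≡ g ⊎ f ∈ₑ ρ

  _∈ᵥ?_ : ∀ {s x y} (z : Fin n) (ρ : Reach G s x y) → Dec (z ∈ᵥ ρ)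
  _∈ᵥ?_ {x = x} z here = z ≟ x
  _∈ᵥ?_ {x = x} z (step _ _ _ ρ) = (z ≟ x) ⊎-dec (z ∈ᵥ? ρ)

  start∈ : ∀ {s x y} (ρ : Reach G s x y) → x ∈ᵥ ρ
  start∈ here = refl
  start∈ (step _ _ _ _) = inj₁ refl

  end∈ : ∀ {s x y} (ρ : Reach G s x y) → y ∈ᵥ ρ
  end∈ here = refl
  end∈ (step _ _ _ ρ) = inj₂ (end∈ ρ)

  walk-edges : ∀ {s x y f} (ρ : Reach G s x y) → f ∈ₑ ρ → E s f
  walk-edges (step _ fs _ _) (inj₁ refl) = fs
  walk-edges (step _ _ _ ρ) (inj₂ f∈ρ) = walk-edges ρ f∈ρ

  walk-ends : ∀ {s x y f} (ρ : Reach G s x y) → f ∈ₑ ρ → end₁ f ∈ᵥ ρ × end₂ f ∈ᵥ ρ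
  walk-ends (step _ _ (inj₁ (refl , refl)) ρ) (inj₁ refl) = inj₁ refl , inj₂ (start∈ ρ)
  walk-ends (step _ _ (inj₂ (refl , refl)) ρ) (inj₁ refl) = inj₂ (start∈ ρ) , inj₁ refl
  walk-ends (step _ _ _ ρ) (inj₂ f∈ρ) = inj₂ (proj₁ (walk-ends ρ f∈ρ)) , inj₂ (proj₂ (walk-ends ρ f∈ρ))

  missing⇒edges-avoid : ∀ {s x y z f} (ρ : Reach G s x y) → ¬ z ∈ᵥ ρ → f ∈ₑ ρ
                      → end₁ f ≢ z × end₂ f ≢ z
  missing⇒edges-avoid ρ z∉ρ f∈ρ =
    (λ eq → z∉ρ (subst (_∈ᵥ ρ) eq (proj₁ (walk-ends ρ f∈ρ)))) ,
    (λ eq → z∉ρ (subst (_∈ᵥ ρ) eq (proj₂ (walk-ends ρ f∈ρ))))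

  from : ∀ {s t x y p} (ρ : Reach G s x y) → (∀ f → f ∈ₑ ρ → E t f) → p ∈ᵥ ρ → Reach G t p y
  from here h refl = here
  from (step f _ j ρ) h (inj₁ refl) =
    step f (h f (inj₁ refl)) j (from ρ (λ g g∈ρ → h g (inj₂ g∈ρ)) (start∈ ρ))
  from (step f _ j ρ) h (inj₂ p∈ρ) = from ρ (λ g g∈ρ → h g (inj₂ g∈ρ)) p∈ρ

  transfer : ∀ {s t x y} (ρ : Reach G s x y) → (∀ f → f ∈ₑ ρ → E t f) → Reach G t x y
  transfer ρ h = from ρ h (start∈ ρ)

  Simple : ∀ {s x y} → Reach G s x y → Set
  Simple here = ⊤
  Simple {x = x} (step _ _ _ ρ) = ¬ x ∈ᵥ ρ × Simple ρ

  suffix : ∀ {s x y z} (ρ : Reach G s x y) → Simple ρ → z ∈ᵥ ρ → Σ (Reach G s z y) Simple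
  suffix here _ refl = here , tt
  suffix (step f fs j ρ) sρ (inj₁ refl) = step f fs j ρ , sρ
  suffix (step _ _ _ ρ) (_ , sρ) (inj₂ z∈ρ) = suffix ρ sρ z∈ρ

  shorten : ∀ {s x y} → Reach G s x y → Σ (Reach G s x y) Simple
  shorten here = here , tt
  shorten {x = x} (step f fs j ρ) with shorten ρ
  ... | ρ′ , sρ′ with x ∈ᵥ? ρ′
  ...   | yes x∈ρ′ = suffix ρ′ sρ′ x∈ρ′
  ...   | no x∉ρ′ = step f fs j ρ′ , x∉ρ′ , sρ′

  escape : ∀ {s u w p z} {D : Sub G} (ρ : Reach G s u w) → Simple ρ → (∀ f → f ∈ₑ ρ → E D f)
         → p ∈ᵥ ρ → p ≢ z → (u ≢ z × Reach G (D ∖ z) p u) ⊎ (w ≢ z × Reach G (D ∖ z) p w)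
  escape here _ _ refl p≢z = inj₁ (p≢z , here)
  escape (step _ _ _ _) _ _ (inj₁ refl) p≢z = inj₁ (p≢z , here)
  escape {u = u} {z = z} (step f _ j ρ) (u∉ρ , sρ) h (inj₂ p∈ρ) p≢z
    with escape ρ sρ (λ g g∈ρ → h g (inj₂ g∈ρ)) p∈ρ p≢z
  ... | inj₂ toEnd = inj₂ toEnd
  ... | inj₁ (y≢z , p⇝y) with u ≟ z
  ...   | no u≢z = inj₁ (u≢z , p⇝y ++ step f (h f (inj₁ refl) , Joins-avoid j u≢z y≢z) (Joins-sym j) here)
  ...   | yes refl =
    inj₂ (w≢u , from ρ (λ g g∈ρ → h g (inj₂ g∈ρ) , missing⇒edges-avoid ρ u∉ρ g∈ρ) p∈ρ)
    where w≢u = λ eq → u∉ρ (subst (_∈ᵥ ρ) eq (end∈ ρ))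

module Subgraphs (G : Graph) where
  open Graph G
  open Walks G

  _∪_ : Sub G → Sub G → Sub G
  s ∪ t = record { V = λ x → V s x ⊎ V t x ; E = λ f → E s f ⊎ E t f }

  ∪-subgraph : ∀ s t → IsSubgraph G s → IsSubgraph G t → IsSubgraph G (s ∪ t)
  ∪-subgraph s t sub-s _ f (inj₁ fs) = inj₁ (proj₁ (sub-s f fs)) , inj₁ (proj₂ (sub-s f fs))
  ∪-subgraph s t _ sub-t f (inj₂ ft) = inj₂ (proj₁ (sub-t f ft)) , inj₂ (proj₂ (sub-t f ft))

  walkSub : ∀ {s x y} → Reach G s x y → Sub G
  walkSub ρ = record { V = _∈ᵥ ρ ; E = _∈ₑ ρ }

  walkSub-subgraph : ∀ {s x y} (ρ : Reach G s x y) → IsSubgraph G (walkSub ρ)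
  walkSub-subgraph ρ f = walk-ends ρ

  ∖-mono : ∀ {s t z x y} → (∀ f → E s f → E t f) → Reach G (s ∖ z) x y → Reach G (t ∖ z) x y
  ∖-mono h = Reach-mono λ f fs → h f (proj₁ fs) , proj₂ fs

  connected-via : ∀ D r → (∀ x → V D x → Reach G D x r) → Connected G D
  connected-via D r h x y x∈D y∈D = h x x∈D ++ reverse (h y y∈D)

  ¬¬-connected : ∀ D → (∀ x y → V D x → V D y → ¬ ¬ Reach G D x y) → ¬ ¬ Connected G D
  ¬¬-connected D h = ¬¬-Π-Fin λ x → ¬¬-Π-Fin λ y → ¬¬-→ λ x∈D → ¬¬-→ λ y∈D → h x y x∈D y∈D

  hub : ∀ D z (K : Fin n → Set)
      → (∀ {k k′} → K k → K k′ → k ≢ z → k′ ≢ z → ¬ ¬ Reach G (D ∖ z) k k′)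
      → (∀ x → V D x → x ≢ z → ¬ ¬ (∃[ k ] K k × k ≢ z × Reach G (D ∖ z) x k))
      → ¬ IsArticulationPoint G D z
  hub D z K joined reaches (_ , x , y , x∈D , y∈D , x≢z , y≢z , _ , x↛y) =
    reaches x x∈D x≢z λ { (k , k∈K , k≢z , x⇝k) →
    reaches y y∈D y≢z λ { (k′ , k′∈K , k′≢z , y⇝k′) →
    joined k∈K k′∈K k≢z k′≢z λ k⇝k′ → x↛y (x⇝k ++ k⇝k′ ++ reverse y⇝k′) } }

  star : ∀ D z r → r ≢ z → (∀ x → V D x → x ≢ z → ¬ ¬ Reach G (D ∖ z) x r)
       → ¬ IsArticulationPoint G D z
  star D z r r≢z reaches =
    hub D z (_≡ r) (λ { refl refl _ _ → contradiction here })
      λ x x∈D x≢z → ¬¬-map (λ x⇝r → r , refl , r≢z , x⇝r) (reaches x x∈D x≢z)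

  biconnected-avoid : ∀ {C} → IsSubgraph G C → Biconnected G C → ∀ z {x y} → V C x → V C y
                    → x ≢ z → y ≢ z → ¬ ¬ Reach G (C ∖ z) x y
  biconnected-avoid {C} sub (conn , no-cut) z {x} {y} x∈C y∈C x≢z y≢z x↛y = ¬¬-excluded-middle λ
    { (yes z∈C) → no-cut z (z∈C , x , y , x∈C , y∈C , x≢z , y≢z , conn x y x∈C y∈C , x↛y)
    ; (no z∉C) → x↛y (transfer (conn x y x∈C y∈C) λ f f∈ρ →
        let fC = walk-edges (conn x y x∈C y∈C) f∈ρ in
        fC , (λ eq → z∉C (subst (V C) eq (proj₁ (sub f fC))))
           , (λ eq → z∉C (subst (V C) eq (proj₂ (sub f fC))))) }

  block-absorbs : ∀ {C} → IsBlock G C → ∀ X → IsSubgraph G (C ∪ X) → Biconnected G (C ∪ X)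
                → ∀ f → E X f → E C f
  block-absorbs {C} (_ , _ , maximal) X sub bic f fX =
    proj₂ (maximal (C ∪ X) sub bic ((λ _ → inj₁) , (λ _ → inj₁))) f (inj₂ fX)

  ear : ∀ {C s u w} → IsBlock G C → (ρ : Reach G s u w) → Simple ρ → V C u → V C w
      → ∀ f → f ∈ₑ ρ → E C f
  ear {C} {u = u} {w} blk@(sub , bic@(conn , _) , _) ρ sρ u∈C w∈C =
    block-absorbs blk (walkSub ρ) (∪-subgraph C (walkSub ρ) sub (walkSub-subgraph ρ))
      (connected-via D w to-w , no-cut)
    where
      D : Sub G
      D = C ∪ walkSub ρ
      to-w : ∀ x → V D x → Reach G D x w
      to-w x (inj₁ x∈C) = Reach-mono (λ _ → inj₁) (conn x w x∈C w∈C)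
      to-w x (inj₂ x∈ρ) = from ρ (λ _ → inj₂) x∈ρ
      no-cut : ∀ z → ¬ IsArticulationPoint G D z
      no-cut z = hub D z (V C)
          (λ k∈C k′∈C k≢z k′≢z →
             ¬¬-map (∖-mono (λ _ → inj₁)) (biconnected-avoid sub bic z k∈C k′∈C k≢z k′≢z))
          to-C
        where
          to-C : ∀ x → V D x → x ≢ z → ¬ ¬ (∃[ k ] V C k × k ≢ z × Reach G (D ∖ z) x k)
          to-C x (inj₁ x∈C) x≢z = contradiction (x , x∈C , x≢z , here)
          to-C x (inj₂ x∈ρ) x≢z with escape ρ sρ (λ _ → inj₂) x∈ρ x≢z
          ... | inj₁ (u≢z , x⇝u) = contradiction (u , u∈C , u≢z , x⇝u)
          ... | inj₂ (w≢z , x⇝w) = contradiction (w , w∈C , w≢z , x⇝w)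

module Lemma2Proof (H : Graph) (v : Fin (Graph.n H)) (tec : TwoEdgeConnected H)
                   (nap : ¬ IsArticulationPoint H (whole H) v)
                   (C : Sub H) (blk : IsBlock H C) (v∈C : V C v) (e : Fin (Graph.m H)) where
  open Graph H
  open Walks H
  open Subgraphs H

  sub-C : IsSubgraph H C
  sub-C = proj₁ blk

  bic-C : Biconnected H C
  bic-C = proj₁ (proj₂ blk)

  a b : Fin n
  a = end₁ e
  b = end₂ e

  H∖v : Sub H
  H∖v = whole H ∖ v

  H∖v∖e : Sub H
  H∖v∖e = deleteEdge H H∖v e

  C∖v∖e : Sub H
  C∖v∖e = deleteEdge H (C ∖ v) e

  H∖v-connected : ¬ ¬ Connected H H∖v
  H∖v-connected = ¬¬-connected H∖v λ x y (_ , x≢v) (_ , y≢v) x↛y →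
    nap (tt , x , y , tt , tt , x≢v , y≢v , proj₁ tec x y tt tt , x↛y)

  bypass : ∀ {x y} → (a ≢ v → b ≢ v → Reach H H∖v∖e a b) → Reach H H∖v x y → Reach H H∖v∖e x y
  bypass detour here = here
  bypass detour (step f fs j ρ) with f ≟ e
  ... | no f≢e = step f (fs , f≢e) j (bypass detour ρ)
  bypass detour (step f (_ , a≢v , b≢v) (inj₁ (refl , refl)) ρ) | yes refl =
    detour a≢v b≢v ++ bypass detour ρ
  bypass detour (step f (_ , a≢v , b≢v) (inj₂ (refl , refl)) ρ) | yes refl =
    reverse (detour a≢v b≢v) ++ bypass detour ρ

  H∖v∖e-connected : (a ≢ v → b ≢ v → Reach H H∖v∖e a b) → ¬ ¬ Connected H H∖v∖e
  H∖v∖e-connected detour = ¬¬-map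
    (λ conn x y (_ , x≢v) (_ , y≢v) → bypass detour (conn x y (tt , x≢v) (tt , y≢v)))
    H∖v-connected

  module CycleThroughV (a≢v : a ≢ v) (b≢v : b ≢ v) (Q : Reach H (deleteEdge H (whole H) e) a b)
                       (simple-Q : Simple Q) (v∈Q : v ∈ᵥ Q) where

    record Spoke : Set where
      field
        root   : Fin n
        root∈C : V C root
        root≢v : root ≢ v
        path   : Reach H H∖v root a
        simple : Simple path
    open Spoke

    cycle : Sub H
    cycle = record { V = _∈ᵥ Q ; E = λ f → f ∈ₑ Q ⊎ f ≡ e }

    fan : Sub H
    fan = record { V = λ x → Σ Spoke λ σ → x ∈ᵥ path σ ; E = λ f → Σ Spoke λ σ → f ∈ₑ path σ }

    D : Sub H
    D = C ∪ (cycle ∪ fan)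

    sub-D : IsSubgraph H D
    sub-D = ∪-subgraph C (cycle ∪ fan) sub-C (∪-subgraph cycle fan sub-cycle sub-fan)
      where
        sub-cycle : IsSubgraph H cycle
        sub-cycle f (inj₁ f∈Q) = walk-ends Q f∈Q
        sub-cycle f (inj₂ refl) = start∈ Q , end∈ Q
        sub-fan : IsSubgraph H fan
        sub-fan f (σ , f∈σ) = (σ , proj₁ (walk-ends (path σ) f∈σ)) , (σ , proj₂ (walk-ends (path σ) f∈σ))

    Q⊆D : ∀ f → f ∈ₑ Q → E D f
    Q⊆D f f∈Q = inj₂ (inj₁ (inj₁ f∈Q))

    e∈D : E D e
    e∈D = inj₂ (inj₁ (inj₂ refl))

    spoke⊆D : (σ : Spoke) → ∀ f → f ∈ₑ path σ → E D f
    spoke⊆D σ f f∈σ = inj₂ (inj₂ (σ , f∈σ))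

    across-e : ∀ {z} → a ≢ z → b ≢ z → Reach H (D ∖ z) a b
    across-e a≢z b≢z = step e (e∈D , a≢z , b≢z) (inj₁ (refl , refl)) here

    around-cycle : ∀ {z x y} → x ∈ᵥ Q → y ∈ᵥ Q → x ≢ z → y ≢ z → Reach H (D ∖ z) x y
    around-cycle x∈Q y∈Q x≢z y≢z
      with escape Q simple-Q Q⊆D x∈Q x≢z | escape Q simple-Q Q⊆D y∈Q y≢z
    ... | inj₁ (_ , x⇝a) | inj₁ (_ , y⇝a) = x⇝a ++ reverse y⇝a
    ... | inj₂ (_ , x⇝b) | inj₂ (_ , y⇝b) = x⇝b ++ reverse y⇝b
    ... | inj₁ (a≢z , x⇝a) | inj₂ (b≢z , y⇝b) = x⇝a ++ across-e a≢z b≢z ++ reverse y⇝b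
    ... | inj₂ (b≢z , x⇝b) | inj₁ (a≢z , y⇝a) = x⇝b ++ reverse (across-e a≢z b≢z) ++ reverse y⇝a

    along-spoke : ∀ {x} (σ : Spoke) → x ∈ᵥ path σ → Reach H (D ∖ v) x a
    along-spoke σ = from (path σ) λ f f∈σ → spoke⊆D σ f f∈σ , proj₂ (walk-edges (path σ) f∈σ)

    connected-D : Connected H D
    connected-D = connected-via D v to-v
      where
        to-v : ∀ x → V D x → Reach H D x v
        to-v x (inj₁ x∈C) = Reach-mono (λ _ → inj₁) (proj₁ bic-C x v x∈C v∈C)
        to-v x (inj₂ (inj₁ x∈Q)) = from Q Q⊆D x∈Q ++ reverse (from Q Q⊆D v∈Q)
        to-v x (inj₂ (inj₂ (σ , x∈σ))) =
          from (path σ) (spoke⊆D σ) x∈σ ++ to-v a (inj₂ (inj₁ (start∈ Q)))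

    v-not-cut : ¬ IsArticulationPoint H D v
    v-not-cut = star D v a a≢v to-a
      where
        to-a : ∀ x → V D x → x ≢ v → ¬ ¬ Reach H (D ∖ v) x a
        to-a x (inj₁ x∈C) x≢v = ¬¬-map
          (λ conn → let (ρ , sρ) = shorten (conn x a (tt , x≢v) (tt , a≢v))
                        σ = record { root∈C = x∈C ; root≢v = x≢v ; path = ρ ; simple = sρ }
                    in along-spoke σ (start∈ ρ))
          H∖v-connected
        to-a x (inj₂ (inj₁ x∈Q)) x≢v = contradiction (around-cycle x∈Q (start∈ Q) x≢v a≢v)
        to-a x (inj₂ (inj₂ (σ , x∈σ))) _ = contradiction (along-spoke σ x∈σ)

    other-not-cut : ∀ z → z ≢ v → ¬ IsArticulationPoint H D z
    other-not-cut z z≢v = star D z v v≢z to-v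
      where
        v≢z : v ≢ z
        v≢z eq = z≢v (sym eq)
        in-C : ∀ {x} → V C x → x ≢ z → ¬ ¬ Reach H (D ∖ z) x v
        in-C x∈C x≢z = ¬¬-map (∖-mono (λ _ → inj₁)) (biconnected-avoid sub-C bic-C z x∈C v∈C x≢z v≢z)
        to-v : ∀ x → V D x → x ≢ z → ¬ ¬ Reach H (D ∖ z) x v
        to-v x (inj₁ x∈C) x≢z = in-C x∈C x≢z
        to-v x (inj₂ (inj₁ x∈Q)) x≢z = contradiction (around-cycle x∈Q v∈Q x≢z v≢z)
        to-v x (inj₂ (inj₂ (σ , x∈σ))) x≢z with escape (path σ) (simple σ) (spoke⊆D σ) x∈σ x≢z
        ... | inj₁ (root≢z , x⇝root) = ¬¬-map (x⇝root ++_) (in-C (root∈C σ) root≢z)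
        ... | inj₂ (a≢z , x⇝a) = contradiction (x⇝a ++ around-cycle (start∈ Q) v∈Q a≢z v≢z)

    no-cut-D : ∀ z → ¬ IsArticulationPoint H D z
    no-cut-D z with z ≟ v
    ... | yes refl = v-not-cut
    ... | no z≢v = other-not-cut z z≢v

    e∈C : E C e
    e∈C = block-absorbs blk (cycle ∪ fan) sub-D (connected-D , no-cut-D) e (inj₁ (inj₂ refl))

  disconnected⇒e∈C : ¬ Connected H H∖v∖e → E C e
  disconnected⇒e∈C disc with a ≟ v | b ≟ v
  ... | yes a≡v | _ = ⊥-elim (H∖v∖e-connected (λ a≢v _ → ⊥-elim (a≢v a≡v)) disc)
  ... | no _ | yes b≡v = ⊥-elim (H∖v∖e-connected (λ _ b≢v → ⊥-elim (b≢v b≡v)) disc)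
  ... | no a≢v | no b≢v with shorten (proj₂ tec e a b tt tt)
  ...   | Q , simple-Q with v ∈ᵥ? Q
  ...     | yes v∈Q = CycleThroughV.e∈C a≢v b≢v Q simple-Q v∈Q
  ...     | no v∉Q = ⊥-elim (H∖v∖e-connected (λ _ _ → transfer Q avoid-v) disc)
    where
      avoid-v : ∀ f → f ∈ₑ Q → E H∖v∖e f
      avoid-v f f∈Q = (tt , missing⇒edges-avoid Q v∉Q f∈Q) , proj₂ (walk-edges Q f∈Q)

  ends-joined : E C e → Connected H C∖v∖e → a ≢ v → b ≢ v → Reach H H∖v∖e a b
  ends-joined e∈C conn a≢v b≢v =
    Reach-mono (λ f fs → (tt , proj₂ (proj₁ fs)) , proj₂ fs)
      (conn a b (proj₁ (sub-C e e∈C) , a≢v) (proj₂ (sub-C e e∈C) , b≢v))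

  restrict-to-block : Connected H H∖v∖e → Connected H C∖v∖e
  restrict-to-block conn x y (x∈C , x≢v) (y∈C , y≢v) =
    transfer ρ λ f f∈ρ → let ((_ , ends≢v) , f≢e) = walk-edges ρ f∈ρ in
      (ear blk ρ sρ x∈C y∈C f f∈ρ , ends≢v) , f≢e
    where
      ρ = proj₁ (shorten (conn x y (tt , x≢v) (tt , y≢v)))
      sρ = proj₂ (shorten (conn x y (tt , x≢v) (tt , y≢v)))

lemma2 : (H : Graph) (v : Fin (Graph.n H)) →
         TwoEdgeConnected H →
         ¬ IsArticulationPoint H (whole H) v →
         (C : Sub H) → IsBlock H C → V C v →
         (e : Fin (Graph.m H)) →
         (¬ Connected H (deleteEdge H (deleteVertex H (whole H) v) e))
           ⇔ (E C e × ¬ Connected H (deleteEdge H (deleteVertex H C v) e))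
lemma2 H v tec nap C blk v∈C e = mk⇔
  (λ disc → let e∈C = disconnected⇒e∈C disc in
    e∈C , λ conn → H∖v∖e-connected (ends-joined e∈C conn) disc)
  (λ (_ , disc) conn → disc (restrict-to-block conn))
  where open Lemma2Proof H v tec nap C blk v∈C e
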